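{- In COT, every ordinal is an index: for every ordinal $x$ there is a class $X$ with $\iota(X)$ defined and $\iota(X)=x$.
   Context: The theory COT is formulated in two-sorted first-order logic with equality. Lower-case variables range over the first sort ("ordinals"), upper-case variables over the second sort ("classes"). The primitives are a relation $x\,\varepsilon\,X$ (ordinal to class), a binary relation $\prec$ on classes, and a partial unary function $\iota$ from classes to ordinals. Write $X\equiv Y$ for $\forall z(z\,\varepsilon\,X\leftrightarrow z\,\varepsilon\,Y)$. An expression $\psi(\{x\mid\phi\})$ abbreviates $\forall X[\forall x(x\,\varepsilon\,X\leftrightarrow\phi)\to\psi(X)]$; in particular $\{x\}$ stands for any class whose only member is $x$. Axioms of COT: (1) Comprehension: $\exists X\forall x(x\,\varepsilon\,X\leftrightarrow\phi)$ for every formula $\phi$ with $X$ not free. (2) $\prec$ is transitive; $X\not\equiv Y\leftrightarrow(X\prec Y\lor Y\prec X)$; for every formula $\phi$, $\phi(X)\to\exists M(\phi(M)\land\forall Y(\phi(Y)\to\neg\,Y\prec M))$. Define $x<y$ iff $\{x\}\prec\{y\}$; $\lim X$ = the $<$-least $l$ with $x<l$ for all $x\,\varepsilon\,X$ (when it exists); $\mathrm{bnd}(X)$ iff $\lim X$ exists. (3) If $\lim X\le y\,\varepsilon\,Y$ then $X\prec Y$. (4) For every $X$ with $\mathrm{bnd}(X)$, $\iota(X)$ is defined and $\iota(X)=\lim\{\iota(Y)\mid Y\prec X\}$. (5) $\exists l\,(\exists k\,(k<l)\land\forall x<l\,\exists y\,(x<y<l))$. (6) If $\mathrm{bnd}(X)$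 and there is a class-given bijection between the members of $X$ and those of $Y$, then $\mathrm{bnd}(Y)$. -}

module Defs where

open import Data.Nat using (ℕ; zero; suc)
open import Data.Fin using (Fin)
open import Data.Product using (Σ; ∃; _×_; _,_)
open import Data.Sum using (_⊎_)
open import Data.Empty using (⊥)
open import Data.Unit using (⊤)
open import Relation.Nullary using (¬_)
open import Relation.Binary.PropositionalEquality using (_≡_)

infixr 2 _⇔_
_⇔_ : Set → Set → Set
A ⇔ B = (A → B) × (B → A)

-- The partial function ι is represented by its graph Iota,
-- required to be functional (Iota X a and Iota X b imply a ≡ b).
-- Equality of the logic is interpreted as propositional equality ≡.

record Structure : Set₁ where
  field
    Ord  : Set
    Cls  : Set
    _ε_  : Ord → Cls → Set
    _≺_  : Cls → Cls → Set
    Iota : Cls → Ord → Set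
    Iota-functional : ∀ {X a b} → Iota X a → Iota X b → a ≡ b

-- First-order formulas of the two-sorted language, with n free
-- ordinal variables and m free class variables (de Bruijn, Fin-indexed).
-- The atom  iota X x  stands for "ι(X) is defined and ι(X) = x".

data Formula (n m : ℕ) : Set where
  _ε'_     : Fin n → Fin m → Formula n m
  _≺'_     : Fin m → Fin m → Formula n m
  iota     : Fin m → Fin n → Formula n m
  _=o_     : Fin n → Fin n → Formula n m
  _=c_     : Fin m → Fin m → Formula n m
  ⊥'       : Formula n m
  _⇒_      : Formula n m → Formula n m → Formula n m
  _∧'_     : Formula n m → Formula n m → Formula n m
  _∨'_     : Formula n m → Formula n m → Formula n m
  ∀o ∃o    : Formula (suc n) m → Formula n m
  ∀c ∃c    : Formula n (suc m) → Formula n m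

module _ (S : Structure) where
  open Structure S

  _∷ᵉ_ : {A : Set} {k : ℕ} → A → (Fin k → A) → Fin (suc k) → A
  (a ∷ᵉ ρ) Fin.zero    = a
  (a ∷ᵉ ρ) (Fin.suc i) = ρ i

  ⟦_⟧ : {n m : ℕ} → Formula n m → (Fin n → Ord) → (Fin m → Cls) → Set
  ⟦ x ε' X ⟧ ρ σ = ρ x ε σ X
  ⟦ X ≺' Y ⟧ ρ σ = σ X ≺ σ Y
  ⟦ iota X x ⟧ ρ σ = Iota (σ X) (ρ x)
  ⟦ x =o y ⟧ ρ σ = ρ x ≡ ρ y
  ⟦ X =c Y ⟧ ρ σ = σ X ≡ σ Y
  ⟦ ⊥' ⟧ ρ σ = ⊥
  ⟦ φ ⇒ ψ ⟧ ρ σ = ⟦ φ ⟧ ρ σ → ⟦ ψ ⟧ ρ σ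
  ⟦ φ ∧' ψ ⟧ ρ σ = ⟦ φ ⟧ ρ σ × ⟦ ψ ⟧ ρ σ
  ⟦ φ ∨' ψ ⟧ ρ σ = ⟦ φ ⟧ ρ σ ⊎ ⟦ ψ ⟧ ρ σ
  ⟦ ∀o φ ⟧ ρ σ = ∀ a → ⟦ φ ⟧ (a ∷ᵉ ρ) σ
  ⟦ ∃o φ ⟧ ρ σ = Σ Ord λ a → ⟦ φ ⟧ (a ∷ᵉ ρ) σ
  ⟦ ∀c φ ⟧ ρ σ = ∀ A → ⟦ φ ⟧ ρ (A ∷ᵉ σ)
  ⟦ ∃c φ ⟧ ρ σ = Σ Cls λ A → ⟦ φ ⟧ ρ (A ∷ᵉ σ)

  _≡ᶜ_ : Cls → Cls → Set
  X ≡ᶜ Y = ∀ z → (z ε X ⇔ z ε Y)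

  IsSingleton : Cls → Ord → Set
  IsSingleton A x = ∀ z → (z ε A ⇔ z ≡ x)

  -- x < y  iff  {x} ≺ {y}, unfolding the abbreviation ψ({x}):
  -- for all classes A, B with A = {x}, B = {y}, A ≺ B.
  _<ₒ_ : Ord → Ord → Set
  x <ₒ y = ∀ A B → IsSingleton A x → IsSingleton B y → A ≺ B

  _≤ₒ_ : Ord → Ord → Set
  x ≤ₒ y = x <ₒ y ⊎ x ≡ y

  StrictUB : Cls → Ord → Set
  StrictUB X l = ∀ x → x ε X → x <ₒ l

  IsLim : Cls → Ord → Set
  IsLim X l = StrictUB X l × (∀ l' → StrictUB X l' → l ≤ₒ l')

  bnd : Cls → Set
  bnd X = Σ Ord λ l → IsLim X l

  BijectionBetween : (Ord → Ord → Set) → Cls → Cls → Set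
  BijectionBetween R X Y =
      (∀ x → x ε X → Σ Ord λ y → y ε Y × R x y)
    × (∀ y → y ε Y → Σ Ord λ x → x ε X × R x y)
    × (∀ x y y' → x ε X → y ε Y → y' ε Y → R x y → R x y' → y ≡ y')
    × (∀ x x' y → x ε X → x' ε X → y ε Y → R x y → R x' y → x ≡ x')

  -- The axioms of COT.  Schemas range over all formulas of the
  -- language, with arbitrary parameters (ρ, σ).
  record IsCOT : Set where
    field
      comprehension : ∀ {n m} (φ : Formula (suc n) m) ρ σ →
        Σ Cls λ X → ∀ x → (x ε X ⇔ ⟦ φ ⟧ (x ∷ᵉ ρ) σ)
      ≺-trans : ∀ X Y Z → X ≺ Y → Y ≺ Z → X ≺ Z
      ≺-total : ∀ X Y → (¬ (X ≡ᶜ Y) ⇔ (X ≺ Y ⊎ Y ≺ X))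
      ≺-minimal : ∀ {n m} (φ : Formula n (suc m)) ρ σ X →
        ⟦ φ ⟧ ρ (X ∷ᵉ σ) →
        Σ Cls λ M → ⟦ φ ⟧ ρ (M ∷ᵉ σ) × (∀ Y → ⟦ φ ⟧ ρ (Y ∷ᵉ σ) → ¬ (Y ≺ M))
      lim-≤-∈ : ∀ X Y l y → IsLim X l → l ≤ₒ y → y ε Y → X ≺ Y
      iota-lim : ∀ X → bnd X →
        Σ Ord λ i → Iota X i ×
          (∀ C → (∀ z → (z ε C ⇔ Σ Cls λ Y → Y ≺ X × Iota Y z)) → IsLim C i)
      limit-exists : Σ Ord λ l → (Σ Ord λ k → k <ₒ l) ×
                       (∀ x → x <ₒ l → Σ Ord λ y → x <ₒ y × y <ₒ l)
      bnd-bij : ∀ {n m} (φ : Formula (suc (suc n)) m) ρ σ X Y → bnd X →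
        BijectionBetween (λ x y → ⟦ φ ⟧ (x ∷ᵉ (y ∷ᵉ ρ)) σ) X Y → bnd Y

record COTModel : Set₁ where
  field
    structure : Structure
    isCOT     : IsCOT structure
  open Structure structure public

module Submission where

-- Suppose x is not an index. The singleton {x} is bounded and ι({x}) ≥ x, so ι({x}) > x;
-- hence among the bounded classes whose index exceeds x there is a ≺-minimal one, M.
-- Since ι(M) = lim {ι(Y) | Y ≺ M} > x, some ι(Y) with Y ≺ M is ≥ x. It cannot be > x,
-- as Y is again bounded and Y ≺ M, so it equals x: x is an index after all.

open import Defs
open import Level using (0ℓ)
open import Axiom.ExcludedMiddle using (ExcludedMiddle)
open import Axiom.DoubleNegationElimination using (em⇒dne)
open import Data.Product using (Σ; _×_; _,_; proj₁; proj₂)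
open import Data.Fin using (Fin; zero; suc)
open import Data.Sum using (_⊎_; inj₁; inj₂)
open import Data.Empty using (⊥-elim)
open import Relation.Nullary using (¬_; yes; no)
open import Relation.Binary.PropositionalEquality using (_≡_; refl; sym; trans; subst)

-- The satisfaction of these formulas unfolds definitionally to IsSingleton, _<ₒ_ and
-- StrictUB, which lets the comprehension and minimality schemas be applied to those notions.
IsSingletonᶠ : ∀ {n m} → Fin m → Fin n → Formula n m
IsSingletonᶠ A x = ∀o (((zero ε' A) ⇒ (zero =o suc x)) ∧' ((zero =o suc x) ⇒ (zero ε' A)))

_<ᶠ_ : ∀ {n m} → Fin n → Fin n → Formula n m
x <ᶠ y = ∀c (∀c (IsSingletonᶠ (suc zero) x ⇒ (IsSingletonᶠ zero y ⇒ (suc zero ≺' zero))))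

StrictUBᶠ : ∀ {n m} → Fin m → Fin n → Formula n m
StrictUBᶠ Y l = ∀o ((zero ε' Y) ⇒ (zero <ᶠ suc l))

module Constructive (M : COTModel) where
  open COTModel M public
  open IsCOT isCOT public

  _≈_ : Cls → Cls → Set
  _≈_ = _≡ᶜ_ structure

  _<_ : Ord → Ord → Set
  _<_ = _<ₒ_ structure

  _≤_ : Ord → Ord → Set
  _≤_ = _≤ₒ_ structure

  Singleton : Cls → Ord → Set
  Singleton = IsSingleton structure

  ≈-refl : ∀ {X} → X ≈ X
  ≈-refl z = (λ a → a) , (λ a → a)

  ≈-sym : ∀ {X Y} → X ≈ Y → Y ≈ X
  ≈-sym e z = proj₂ (e z) , proj₁ (e z)

  ≈-trans : ∀ {X Y Z} → X ≈ Y → Y ≈ Z → X ≈ Z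
  ≈-trans e f z = (λ a → proj₁ (f z) (proj₁ (e z) a)) , (λ a → proj₂ (e z) (proj₂ (f z) a))

  ≺⇒≉ : ∀ {X Y} → X ≺ Y → ¬ (X ≈ Y)
  ≺⇒≉ {X} {Y} p = proj₂ (≺-total X Y) (inj₁ p)

  ≺-irrefl : ∀ {X} → ¬ (X ≺ X)
  ≺-irrefl p = ≺⇒≉ p ≈-refl

  ≺-asym : ∀ {X Y} → X ≺ Y → ¬ (Y ≺ X)
  ≺-asym {X} {Y} p q = ≺-irrefl (≺-trans X Y X p q)

  ≺-respˡ-≈ : ∀ {X X' Y} → X ≈ X' → X ≺ Y → X' ≺ Y
  ≺-respˡ-≈ {X} {X'} {Y} e p with proj₁ (≺-total X' Y) (λ e' → ≺⇒≉ p (≈-trans e e'))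
  ... | inj₁ q = q
  ... | inj₂ q = ⊥-elim (≺⇒≉ (≺-trans X Y X' p q) e)

  ≺-respʳ-≈ : ∀ {X Y Y'} → Y ≈ Y' → X ≺ Y → X ≺ Y'
  ≺-respʳ-≈ {X} {Y} {Y'} e p with proj₁ (≺-total X Y') (λ e' → ≺⇒≉ p (≈-trans e' (≈-sym e)))
  ... | inj₁ q = q
  ... | inj₂ q = ⊥-elim (≺⇒≉ (≺-trans Y' X Y q p) (≈-sym e))

  singleton : ∀ x → Σ Cls λ A → Singleton A x
  singleton x = comprehension {1} {0} (zero =o suc zero) (λ _ → x) (λ ())

  singleton-unique : ∀ {A B x} → Singleton A x → Singleton B x → A ≈ B
  singleton-unique sA sB z =
    (λ a → proj₂ (sB z) (proj₁ (sA z) a)) , (λ b → proj₂ (sA z) (proj₁ (sB z) b))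

  ≺⇒< : ∀ {A B x y} → Singleton A x → Singleton B y → A ≺ B → x < y
  ≺⇒< sA sB p A' B' sA' sB' =
    ≺-respʳ-≈ (singleton-unique sB sB') (≺-respˡ-≈ (singleton-unique sA sA') p)

  <-irrefl : ∀ {x} → ¬ (x < x)
  <-irrefl {x} x<x = let (A , sA) = singleton x in ≺-irrefl (x<x A A sA sA)

  <-trans : ∀ {x y z} → x < y → y < z → x < z
  <-trans {x} {y} {z} p q =
    let (A , sA) = singleton x ; (B , sB) = singleton y ; (C , sC) = singleton z
    in ≺⇒< sA sC (≺-trans A B C (p A B sA sB) (q B C sB sC))

  ≤⇒≯ : ∀ {x y} → x ≤ y → ¬ (y < x)
  ≤⇒≯ (inj₁ x<y) y<x = <-irrefl (<-trans x<y y<x)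
  ≤⇒≯ (inj₂ refl) x<x = <-irrefl x<x

  IndicesBelow : Cls → Cls → Set
  IndicesBelow C X = ∀ z → (z ε C ⇔ Σ Cls λ Y → Y ≺ X × Iota Y z)

  indicesBelow : ∀ X → Σ Cls λ C → IndicesBelow C X
  indicesBelow X = comprehension {0} {1} (∃c ((zero ≺' suc zero) ∧' iota zero zero)) (λ ()) (λ _ → X)

  Iota-monotone : ∀ {X Y a b} → bnd structure X → Y ≺ X → Iota Y a → Iota X b → a < b
  Iota-monotone {X} {Y} {a} bX Y≺X ia ib =
    let (i , ii , lim) = iota-lim X bX
        (C , hC) = indicesBelow X
        (ub , _) = lim C hC
    in subst (a <_) (Iota-functional ii ib) (ub a (proj₂ (hC a) (Y , Y≺X , ia)))

module Classical (em : ExcludedMiddle 0ℓ) (M : COTModel) where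
  open Constructive M public

  dne : {P : Set} → ¬ ¬ P → P
  dne = em⇒dne em

  <-trichotomy : ∀ x y → x < y ⊎ x ≡ y ⊎ y < x
  <-trichotomy x y with em {x ≡ y}
  ... | yes x≡y = inj₂ (inj₁ x≡y)
  ... | no x≢y with singleton x | singleton y
  ... | A , sA | B , sB with proj₁ (≺-total A B) (λ e → x≢y (proj₁ (sB x) (proj₁ (e x) (proj₂ (sA x) refl))))
  ... | inj₁ A≺B = inj₁ (≺⇒< sA sB A≺B)
  ... | inj₂ B≺A = inj₂ (inj₂ (≺⇒< sB sA B≺A))

  ≯⇒≤ : ∀ {x y} → ¬ (y < x) → x ≤ y
  ≯⇒≤ {x} {y} y≮x with <-trichotomy x y
  ... | inj₁ x<y = inj₁ x<y
  ... | inj₂ (inj₁ x≡y) = inj₂ x≡y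
  ... | inj₂ (inj₂ y<x) = ⊥-elim (y≮x y<x)

  -- The least strict upper bound is the one whose singleton is ≺-minimal.
  strictUB⇒bnd : ∀ {X u} → StrictUB structure X u → bnd structure X
  strictUB⇒bnd {X} {u} ub =
    let (Au , sAu) = singleton u
        (Mn , (o , sM , ubo) , minimal) =
          ≺-minimal {0} {1} (∃o (IsSingletonᶠ zero zero ∧' StrictUBᶠ (suc zero) zero))
                    (λ ()) (λ _ → X) Au (u , sAu , ub)
        least : ∀ l → StrictUB structure X l → o ≤ l
        least l ubl = ≯⇒≤ λ l<o →
          let (B , sB) = singleton l in minimal B (l , sB , ubl) (l<o B Mn sB sM)
    in o , ubo , least

  ≺-bnd⇒strictUB : ∀ {X Y} → bnd structure X → Y ≺ X → Σ Ord (StrictUB structure Y)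
  ≺-bnd⇒strictUB {X} {Y} (l , limX) Y≺X =
    l , λ y y∈Y → dne λ y≮l → ≺-asym Y≺X (lim-≤-∈ X Y l y limX (≯⇒≤ y≮l) y∈Y)

  -- Axiom 5 provides a bounded singleton {k}; axiom 6 transfers boundedness to {x}, via the
  -- trivially true relation, which is a bijection between any two singletons.
  singleton-bnd : ∀ {A x} → Singleton A x → bnd structure A
  singleton-bnd {A} {x} sA =
    let (l , (k , k<l) , _) = limit-exists
        (Ak , sAk) = singleton k
        bk = strictUB⇒bnd {Ak} {l} λ z z∈Ak → subst (_< l) (sym (proj₁ (sAk z) z∈Ak)) k<l
        bij = (λ _ _ → x , proj₂ (sA x) refl , λ ())
            , (λ _ _ → k , proj₂ (sAk k) refl , λ ())
            , (λ _ b b' _ b∈A b'∈A _ _ → trans (proj₁ (sA b) b∈A) (sym (proj₁ (sA b') b'∈A)))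
            , (λ a a' _ a∈Ak a'∈Ak _ _ _ → trans (proj₁ (sAk a) a∈Ak) (sym (proj₁ (sAk a') a'∈Ak)))
    in bnd-bij {0} {0} (⊥' ⇒ ⊥') (λ ()) (λ ()) Ak A bk bij

  -- A ≺-minimal singleton {o} with ι({o}) = w < o would have {w} ≺ {o} and hence
  -- ι({w}) < ι({o}) = w, making {w} a smaller counterexample.
  singleton-Iota-≥ : ∀ {A x w} → Singleton A x → Iota A w → x ≤ w
  singleton-Iota-≥ {A} {x} {w} sA iw = ≯⇒≤ λ w<x →
    let (Mn , (o , w' , sM , iM , w'<o) , minimal) =
          ≺-minimal {0} {0}
            (∃o (∃o (IsSingletonᶠ zero (suc zero) ∧' (iota zero zero ∧' (zero <ᶠ suc zero)))))
            (λ ()) (λ ()) A (x , w , sA , iw , w<x)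
        (B , sB) = singleton w'
        (v , iv , _) = iota-lim B (singleton-bnd sB)
        B≺M = w'<o B Mn sB sM
        w'≤v = ≯⇒≤ λ v<w' → minimal B (w' , v , sB , iv , v<w') B≺M
    in ≤⇒≯ w'≤v (Iota-monotone (singleton-bnd sM) B≺M iv iM)

  below-lim⇒≤-member : ∀ {C i x} → IsLim structure C i → x < i → Σ Ord λ z → z ε C × x ≤ z
  below-lim⇒≤-member {C} {x = x} (_ , least) x<i = dne λ no-member →
    let x-bounds-C : StrictUB structure C x
        x-bounds-C z z∈C = dne λ z≮x → no-member (z , z∈C , ≯⇒≤ z≮x)
    in ≤⇒≯ (least x x-bounds-C) x<i

  Index : Ord → Set
  Index x = Σ Cls λ X → Iota X x

  BoundedIndexedAbove : Ord → Cls → Set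
  BoundedIndexedAbove x Y = Σ Ord (StrictUB structure Y) × Σ Ord λ o → Iota Y o × x < o

  BoundedIndexedAboveᶠ : Formula 1 1
  BoundedIndexedAboveᶠ = ∃o (StrictUBᶠ zero zero) ∧' ∃o (iota zero zero ∧' (suc zero <ᶠ zero))

  singleton-BoundedIndexedAbove : ∀ {x} → ¬ Index x → Σ Cls (BoundedIndexedAbove x)
  singleton-BoundedIndexedAbove {x} ¬idx with singleton x
  ... | A , sA with singleton-bnd sA
  ... | bA@(l , ub , _) with iota-lim A bA
  ... | w , iw , _ with singleton-Iota-≥ sA iw
  ...   | inj₁ x<w = A , (l , ub) , (w , iw , x<w)
  ...   | inj₂ refl = ⊥-elim (¬idx (A , iw))

  minimal-BoundedIndexedAbove⇒Index : ∀ {x N} → BoundedIndexedAbove x N →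
                                      (∀ Y → BoundedIndexedAbove x Y → ¬ (Y ≺ N)) → Index x
  minimal-BoundedIndexedAbove⇒Index {x} {N} ((_ , ub) , (o , iN , x<o)) minimal
    with strictUB⇒bnd ub
  ... | bN with iota-lim N bN | indicesBelow N
  ... | _ , ii , lim | C , hC
    with below-lim⇒≤-member (lim C hC) (subst (x <_) (Iota-functional iN ii) x<o)
  ... | z , z∈C , x≤z with proj₁ (hC z) z∈C
  ... | Y , Y≺N , iY with x≤z
  ...   | inj₁ x<z = ⊥-elim (minimal Y (≺-bnd⇒strictUB bN Y≺N , z , iY , x<z) Y≺N)
  ...   | inj₂ refl = Y , iY

mainTheorem9 : ExcludedMiddle 0ℓ → (M : COTModel) →
    ∀ (x : COTModel.Ord M) → Σ (COTModel.Cls M) λ X → COTModel.Iota M X x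
mainTheorem9 em M x = dne λ ¬idx →
  let (A , A-above) = singleton-BoundedIndexedAbove ¬idx
      (N , N-above , minimal) = ≺-minimal BoundedIndexedAboveᶠ (λ _ → x) (λ ()) A A-above
  in ¬idx (minimal-BoundedIndexedAbove⇒Index N-above minimal)
  where open Classical em M
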